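{- Let $\Gamma$ be a graph on a finite set $\Pi$ with $l=\#\Pi$, let $o\in Or(\Gamma)$ and $\alpha\in\Pi$. If $\alpha$ is maximal with respect to $o$, then $$\sigma(o,\alpha,0)\ge\sigma(o,\alpha,1)\ge\cdots\ge\sigma(o,\alpha,l-2)\ge\sigma(o,\alpha,l-1).$$ If $\alpha$ is minimal with respect to $o$, then $$\sigma(o,\alpha,0)\le\sigma(o,\alpha,1)\le\cdots\le\sigma(o,\alpha,l-2)\le\sigma(o,\alpha,l-1).$$ If moreover $\alpha$ is not an isolated vertex of $\Gamma$, then the smallest term in the respective sequence is zero.
   Context: A graph on a finite set $\Pi$ is a simple graph with vertex set $\Pi$. An acyclic orientation $o$ of $\Gamma$ is a choice of direction $\alpha<_o\beta$ for each edge with no directed cycle; $Or(\Gamma)$ is the set of these. A vertex $\alpha$ is maximal (resp. minimal) with respect to $o$ if $\beta<_o\alpha$ (resp. $\alpha<_o\beta$) for every edge $\overline{\alpha\beta}$ at $\alpha$. $\Sigma(o)$ is the set of linear orderings $c$ of $\Pi$ with $\alpha<_c\beta$ for every edge oriented $\alpha<_o\beta$. For $r\in\mathbb{Z}_{\ge0}$, $\Sigma(o,\alpha,r):=\{c\in\Sigma(o)\mid\#\{\beta\in\Pi\mid\alpha<_c\beta\}=r\}$ and $\sigma(o,\alpha,r):=\#\Sigma(o,\alpha,r)$. -}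

module Defs where

open import Data.Bool using (Bool; true; false)
open import Data.Nat as ℕ using (ℕ; zero; suc)
open import Data.Fin as Fin using (Fin; _<_; _<?_)
open import Data.Fin.Properties using (all?; _≟_)
open import Data.Vec using (Vec; []; _∷_; lookup)
open import Data.Sum using (_⊎_)
open import Data.List using (List; allFin; [_]; concatMap; map; filter; length)
open import Data.Product using (_×_; ∃)
open import Data.Bool.Properties using () renaming (_≟_ to _≟ᵇ_)
open import Relation.Nullary using (Dec; ¬_)
open import Relation.Nullary.Decidable using (_×-dec_; _→-dec_)
open import Relation.Binary.PropositionalEquality using (_≡_)
open import Relation.Binary.Construct.Closure.Transitive using (TransClosure)

record Graph (l : ℕ) : Set where
  field
    adj   : Fin l → Fin l → Bool
    sym   : ∀ a b → adj a b ≡ adj b a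
    irrfl : ∀ a → adj a a ≡ false
open Graph public

_⟪_⟫_ : ∀ {l} → Fin l → (Fin l → Fin l → Bool) → Fin l → Set
a ⟪ o ⟫ b = o a b ≡ true

record IsAcyclicOrientation {l : ℕ} (Γ : Graph l) (o : Fin l → Fin l → Bool) : Set where
  field
    onlyEdges : ∀ a b → o a b ≡ true → adj Γ a b ≡ true
    oriented  : ∀ a b → adj Γ a b ≡ true → (o a b ≡ true) ⊎ (o b a ≡ true)
    notBoth   : ∀ a b → o a b ≡ true → ¬ (o b a ≡ true)
    acyclic   : ∀ a → ¬ TransClosure (λ x y → x ⟪ o ⟫ y) a a

Or : ∀ {l} → Graph l → Set
Or {l} Γ = ∃ λ (o : Fin l → Fin l → Bool) → IsAcyclicOrientation Γ o

IsMaximal : ∀ {l} (Γ : Graph l) → (Fin l → Fin l → Bool) → Fin l → Set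
IsMaximal Γ o α = ∀ β → adj Γ α β ≡ true → β ⟪ o ⟫ α

IsMinimal : ∀ {l} (Γ : Graph l) → (Fin l → Fin l → Bool) → Fin l → Set
IsMinimal Γ o α = ∀ β → adj Γ α β ≡ true → α ⟪ o ⟫ β

IsIsolated : ∀ {l} (Γ : Graph l) → Fin l → Set
IsIsolated Γ α = ∀ β → adj Γ α β ≡ false

-- A linear ordering c of Fin l is encoded by its position vector
-- pos : Vec (Fin l) l, an injective (hence bijective) map Π → Fin l;
-- a <_c b  iff  pos a < pos b.  Distinct orderings ↔ distinct vectors.
allVecs : (l n : ℕ) → List (Vec (Fin l) n)
allVecs l zero    = [ [] ]
allVecs l (suc n) = concatMap (λ v → map (_∷ v) (allFin l)) (allVecs l n)

IsLinearOrder : ∀ {l} → Vec (Fin l) l → Set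
IsLinearOrder {l} pos = ∀ a b → lookup pos a ≡ lookup pos b → a ≡ b

Compatible : ∀ {l} → (Fin l → Fin l → Bool) → Vec (Fin l) l → Set
Compatible o pos = ∀ a b → o a b ≡ true → lookup pos a < lookup pos b

countAbove : ∀ {l} → Vec (Fin l) l → Fin l → ℕ
countAbove {l} pos α = length (filter (λ β → lookup pos α <? lookup pos β) (allFin l))

InSigma : ∀ {l} → (Fin l → Fin l → Bool) → Fin l → ℕ → Vec (Fin l) l → Set
InSigma o α r pos = IsLinearOrder pos × Compatible o pos × countAbove pos α ≡ r

InSigma? : ∀ {l} (o : Fin l → Fin l → Bool) α r pos → Dec (InSigma o α r pos)
InSigma? o α r pos =
  all? (λ a → all? (λ b → (lookup pos a ≟ lookup pos b) →-dec (a ≟ b)))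
  ×-dec all? (λ a → all? (λ b → (o a b ≟ᵇ true) →-dec (lookup pos a <? lookup pos b)))
  ×-dec (countAbove pos α ℕ.≟ r)

σ : ∀ {l} → (Fin l → Fin l → Bool) → Fin l → ℕ → ℕ
σ {l} o α r = length (filter (InSigma? o α r) (allVecs l l))

{-# OPTIONS --safe #-}
module Submission where

-- Orderings are position vectors, so for a linear ordering the number of elements above α is
-- fixed by the position p of α: it is l - 1 - p. If α has no o-successor (as when α is maximal),
-- exchanging α with the element directly above it keeps every oriented edge increasing and
-- lowers that number by one; the new position of α determines the exchange, so this injects
-- Σ(o,α,r+1) into Σ(o,α,r). Dually, if α has no o-predecessor (as when α is minimal), exchanging
-- α with the element directly below it injects Σ(o,α,r) into Σ(o,α,r+1); for r < l - 1, α is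
-- not at the bottom, so there is such an element. A neighbour of a maximal α lies below
-- it in every ordering of Σ(o), so α is never at the bottom and σ(o,α,l-1) = 0; dually a minimal
-- α with a neighbour is never on top and σ(o,α,0) = 0.

open import Defs hiding (sym)
open import Data.Bool using (Bool; true)
open import Data.Bool.Properties using (¬-not) renaming (_≟_ to _≟ᵇ_)
open import Data.Empty using (⊥-elim)
open import Data.Fin as Fin using (Fin; zero; suc; toℕ; inject₁; lower₁; punchOut; _<?_)
open import Data.Fin.Properties
  using (any?; _≟_; toℕ<n; toℕ-inject₁; inject₁-lower₁; injective⇒≤; punchOut-injective)
import Data.Fin.Properties as Finₚ
open import Data.List as List using (List; []; _∷_; length; filter; allFin; cartesianProductWith)
open import Data.List.Properties
  using (length-tabulate; map-tabulate; filter-all; filter-none; filter-reject; filter-≐)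
open import Data.List.Membership.Propositional using (_∈_)
open import Data.List.Membership.Propositional.Properties
  using (∈-filter⁺; ∈-filter⁻; ∈-allFin; ∈-lookup; ∈-cartesianProductWith⁺)
import Data.List.Relation.Unary.All as All
open import Data.List.Relation.Unary.Any using (here; index)
open import Data.List.Relation.Unary.Any.Properties using (lookup-index)
open import Data.List.Relation.Unary.Unique.Propositional using (Unique; []; _∷_)
import Data.List.Relation.Unary.Unique.Propositional.Properties as Unique
open import Data.Nat using (ℕ; suc; _+_; _≤_; _<_; z<s; s<s; s<s⁻¹; s≤s⁻¹)
open import Data.Nat.Properties
  using ( ≤-refl; ≤-antisym; <-irrefl; <-≤-trans; n≮n; n≮0; +-suc; +-identityʳ; +-cancelˡ-≡; +-cancelʳ-≡
        ; suc-injective; m≢1+n+m)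
open import Data.Product as Product using (_×_; _,_; ∃; proj₁; proj₂)
open import Data.Vec as Vec using (Vec; []; _∷_; lookup)
open import Data.Vec.Properties using (lookup-map; ∷-injective)
open import Function using (_∘_; id; Injective)
open import Level using (0ℓ)
open import Relation.Nullary using (¬_; yes; no)
open import Relation.Unary using (Pred; Decidable)
open import Relation.Binary.PropositionalEquality
  using (_≡_; _≢_; refl; sym; trans; cong; cong₂; subst; subst₂; module ≡-Reasoning)

Unique-lookup-injective : ∀ {A : Set} {xs : List A} → Unique xs →
  ∀ {i j} → List.lookup xs i ≡ List.lookup xs j → i ≡ j
Unique-lookup-injective (_  ∷ _) {zero}  {zero}  _ = refl
Unique-lookup-injective (x∉ ∷ _) {zero}  {suc j} e = ⊥-elim (All.lookup x∉ (∈-lookup j) e)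
Unique-lookup-injective (x∉ ∷ _) {suc i} {zero}  e = ⊥-elim (All.lookup x∉ (∈-lookup i) (sym e))
Unique-lookup-injective (_  ∷ u) {suc i} {suc j} e = cong suc (Unique-lookup-injective u e)

length-≤-of-injection : ∀ {A B : Set} {xs : List A} {ys : List B} → Unique xs →
  (f : ∀ {x} → x ∈ xs → B) → (∀ {x} (x∈ : x ∈ xs) → f x∈ ∈ ys) →
  (∀ {x y} (x∈ : x ∈ xs) (y∈ : y ∈ xs) → f x∈ ≡ f y∈ → x ≡ y) →
  length xs ≤ length ys
length-≤-of-injection {xs = xs} {ys} u f f∈ f-injective = injective⇒≤ g-injective
  where
  g : Fin (length xs) → Fin (length ys)
  g i = index (f∈ (∈-lookup i))

  g-injective : Injective _≡_ _≡_ g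
  g-injective {i} {j} e = Unique-lookup-injective u (f-injective _ _ (begin
    f (∈-lookup i)            ≡⟨ lookup-index (f∈ _) ⟩
    List.lookup ys (g i)      ≡⟨ cong (List.lookup ys) e ⟩
    List.lookup ys (g j)      ≡⟨ lookup-index (f∈ _) ⟨
    f (∈-lookup j)            ∎))
    where open ≡-Reasoning

module _ {A B : Set} {P : Pred A 0ℓ} {Q : Pred B 0ℓ} (P? : Decidable P) (Q? : Decidable Q) where

  length-filter-≤-of-injection : ∀ {xs ys} → Unique xs → (∀ y → y ∈ ys) →
    (f : ∀ x → P x → B) → (∀ x (px : P x) → Q (f x px)) →
    (∀ {x y} (px : P x) (py : P y) → f x px ≡ f y py → x ≡ y) →
    length (filter P? xs) ≤ length (filter Q? ys)
  length-filter-≤-of-injection {xs} u complete f Q-f f-injective =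
    length-≤-of-injection (Unique.filter⁺ P? u) (λ x∈ → f _ (holds x∈))
      (λ x∈ → ∈-filter⁺ Q? (complete _) (Q-f _ (holds x∈)))
      (λ x∈ y∈ → f-injective (holds x∈) (holds y∈))
    where
    holds : ∀ {x} → x ∈ filter P? xs → P x
    holds = proj₂ ∘ ∈-filter⁻ P? {xs = xs}

length-filter-map : ∀ {A B : Set} {P : Pred B 0ℓ} (P? : Decidable P) (f : A → B) xs →
  length (filter P? (List.map f xs)) ≡ length (filter (P? ∘ f) xs)
length-filter-map P? f [] = refl
length-filter-map P? f (x ∷ xs) with P? (f x)
... | yes _ = cong suc (length-filter-map P? f xs)
... | no _  = length-filter-map P? f xs

length-filter-allFin-suc : ∀ {n} {P : Pred (Fin (suc n)) 0ℓ} (P? : Decidable P) → ¬ P zero →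
  length (filter P? (allFin (suc n))) ≡ length (filter (P? ∘ Fin.suc) (allFin n))
length-filter-allFin-suc {n} P? ¬P0 = begin
  length (filter P? (allFin (suc n)))
    ≡⟨ cong (length ∘ filter P? ∘ (zero ∷_)) (map-tabulate id Fin.suc) ⟨
  length (filter P? (zero ∷ List.map Fin.suc (allFin n))) ≡⟨ cong length (filter-reject P? ¬P0) ⟩
  length (filter P? (List.map Fin.suc (allFin n)))        ≡⟨ length-filter-map P? Fin.suc (allFin n) ⟩
  length (filter (P? ∘ Fin.suc) (allFin n))               ∎
  where open ≡-Reasoning

length-filter-<-allFin : ∀ {n} (p : Fin (suc n)) → length (filter (p <?_) (allFin (suc n))) + toℕ p ≡ n
length-filter-<-allFin {n} p@zero = begin
  length (filter (p <?_) (allFin (suc n))) + 0   ≡⟨ +-identityʳ _ ⟩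
  length (filter (p <?_) (allFin (suc n)))       ≡⟨ length-filter-allFin-suc {n} (p <?_) (λ ()) ⟩
  length (filter ((p <?_) ∘ Fin.suc) (allFin n))
    ≡⟨ cong length (filter-all _ (All.universal (λ _ → z<s) (allFin n))) ⟩
  length (allFin n)                              ≡⟨ length-tabulate id ⟩
  n                                              ∎
  where open ≡-Reasoning
length-filter-<-allFin {suc n} (suc p) = begin
  length (filter (suc p <?_) (allFin (suc (suc n)))) + suc (toℕ p)   ≡⟨ +-suc _ (toℕ p) ⟩
  suc (length (filter (suc p <?_) (allFin (suc (suc n)))) + toℕ p)   ≡⟨ cong (λ k → suc (k + toℕ p)) shift ⟩
  suc (length (filter (p <?_) (allFin (suc n))) + toℕ p)             ≡⟨ cong suc (length-filter-<-allFin p) ⟩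
  suc n                                                              ∎
  where
  open ≡-Reasoning
  shift : length (filter (suc p <?_) (allFin (suc (suc n)))) ≡ length (filter (p <?_) (allFin (suc n)))
  shift = trans (length-filter-allFin-suc {suc n} (suc p <?_) (λ ()))
                (cong length (filter-≐ ((suc p <?_) ∘ Fin.suc) (p <?_) (s<s⁻¹ , s<s) (allFin (suc n))))

injective⇒surjective : ∀ {n} {g : Fin n → Fin n} → Injective _≡_ _≡_ g → ∀ q → ∃ λ a → g a ≡ q
injective⇒surjective {suc n} {g} g-injective q with any? (λ a → g a ≟ q)
... | yes hit = hit
... | no miss = ⊥-elim (n≮n n (injective⇒≤ punched-injective))
  where
  punched : Fin (suc n) → Fin n
  punched a = punchOut {i = q} (λ e → miss (a , sym e))

  punched-injective : Injective _≡_ _≡_ punched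
  punched-injective e = g-injective (punchOut-injective {i = q} _ _ e)

length-filter-∘-injective : ∀ {n} {P : Pred (Fin n) 0ℓ} (P? : Decidable P) (g : Fin n → Fin n) →
  Injective _≡_ _≡_ g → length (filter (P? ∘ g) (allFin n)) ≡ length (filter P? (allFin n))
length-filter-∘-injective {n} {P} P? g g-injective = ≤-antisym
  (length-filter-≤-of-injection (P? ∘ g) P? (Unique.allFin⁺ n) ∈-allFin
    (λ a _ → g a) (λ _ → id) (λ _ _ → g-injective))
  (length-filter-≤-of-injection P? (P? ∘ g) (Unique.allFin⁺ n) ∈-allFin
    (λ q _ → preimage q) (λ q → subst P (sym (preimage-sound q)))
    (λ {q} {q′} _ _ e → trans (sym (preimage-sound q)) (trans (cong g e) (preimage-sound q′))))
  where
  preimage : Fin n → Fin n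
  preimage q = proj₁ (injective⇒surjective g-injective q)

  preimage-sound : ∀ q → g (preimage q) ≡ q
  preimage-sound q = proj₂ (injective⇒surjective g-injective q)

countAbove+position≡n : ∀ {n} (pos : Vec (Fin (suc n)) (suc n)) α → IsLinearOrder pos →
  countAbove pos α + toℕ (lookup pos α) ≡ n
countAbove+position≡n pos α linear =
  trans (cong (_+ toℕ (lookup pos α)) (length-filter-∘-injective (lookup pos α <?_) (lookup pos) (linear _ _)))
        (length-filter-<-allFin (lookup pos α))

swapAdjacent : ∀ {n} → Fin n → Fin (suc n) → Fin (suc n)
swapAdjacent zero    zero          = suc zero
swapAdjacent zero    (suc zero)    = zero
swapAdjacent zero    (suc (suc k)) = suc (suc k)
swapAdjacent (suc i) zero          = zero
swapAdjacent (suc i) (suc k)       = suc (swapAdjacent i k)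

swapAdjacent-involutive : ∀ {n} (i : Fin n) k → swapAdjacent i (swapAdjacent i k) ≡ k
swapAdjacent-involutive zero    zero          = refl
swapAdjacent-involutive zero    (suc zero)    = refl
swapAdjacent-involutive zero    (suc (suc k)) = refl
swapAdjacent-involutive (suc i) zero          = refl
swapAdjacent-involutive (suc i) (suc k)       = cong suc (swapAdjacent-involutive i k)

swapAdjacent-injective : ∀ {n} (i : Fin n) → Injective _≡_ _≡_ (swapAdjacent i)
swapAdjacent-injective i {x} {y} e = begin
  x                                 ≡⟨ swapAdjacent-involutive i x ⟨
  swapAdjacent i (swapAdjacent i x) ≡⟨ cong (swapAdjacent i) e ⟩
  swapAdjacent i (swapAdjacent i y) ≡⟨ swapAdjacent-involutive i y ⟩
  y                                 ∎
  where open ≡-Reasoning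

swapAdjacent-inject₁ : ∀ {n} (i : Fin n) → swapAdjacent i (inject₁ i) ≡ suc i
swapAdjacent-inject₁ zero    = refl
swapAdjacent-inject₁ (suc i) = cong suc (swapAdjacent-inject₁ i)

swapAdjacent-suc : ∀ {n} (i : Fin n) → swapAdjacent i (suc i) ≡ inject₁ i
swapAdjacent-suc zero    = refl
swapAdjacent-suc (suc i) = cong suc (swapAdjacent-suc i)

swapAdjacent-< : ∀ {n} (i : Fin n) {x y} → x Fin.< y → ¬ (x ≡ inject₁ i × y ≡ suc i) →
  swapAdjacent i x Fin.< swapAdjacent i y
swapAdjacent-< zero    {zero}        {suc zero}    _   swapped = ⊥-elim (swapped (refl , refl))
swapAdjacent-< zero    {zero}        {suc (suc _)} _   _       = s<s z<s
swapAdjacent-< zero    {suc zero}    {suc (suc _)} _   _       = z<s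
swapAdjacent-< zero    {suc (suc _)} {suc (suc _)} x<y _       = x<y
swapAdjacent-< zero    {suc zero}    {suc zero}    (s<s ())
swapAdjacent-< zero    {suc (suc _)} {suc zero}    (s<s ())
swapAdjacent-< (suc i) {zero}        {suc _}       _   _       = z<s
swapAdjacent-< (suc i) {suc _}       {suc _}       x<y swapped =
  s<s (swapAdjacent-< i (s<s⁻¹ x<y) (swapped ∘ Product.map (cong suc) (cong suc)))

Vec-map-injective : ∀ {A B : Set} {f : A → B} → Injective _≡_ _≡_ f →
  ∀ {n} {u v : Vec A n} → Vec.map f u ≡ Vec.map f v → u ≡ v
Vec-map-injective f-injective {u = []}    {[]}    _ = refl
Vec-map-injective f-injective {u = _ ∷ _} {_ ∷ _} e =
  let head≡ , tail≡ = ∷-injective e in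
  cong₂ _∷_ (f-injective head≡) (Vec-map-injective f-injective tail≡)

allVecs-suc : ∀ l n → allVecs l (suc n) ≡ cartesianProductWith (λ v a → a ∷ v) (allVecs l n) (allFin l)
allVecs-suc l n = go (allVecs l n)
  where
  go : ∀ vs → List.concatMap (λ v → List.map (_∷ v) (allFin l)) vs
            ≡ cartesianProductWith (λ v a → a ∷ v) vs (allFin l)
  go []       = refl
  go (v ∷ vs) = cong (List.map (_∷ v) (allFin l) List.++_) (go vs)

∈-allVecs : ∀ {l n} (v : Vec (Fin l) n) → v ∈ allVecs l n
∈-allVecs         []      = here refl
∈-allVecs {l} {suc n} (a ∷ v) = subst (a ∷ v ∈_) (sym (allVecs-suc l n))
  (∈-cartesianProductWith⁺ (λ v a → a ∷ v) (∈-allVecs v) (∈-allFin a))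

allVecs-unique : ∀ l n → Unique (allVecs l n)
allVecs-unique l 0       = All.[] ∷ []
allVecs-unique l (suc n) = subst Unique (sym (allVecs-suc l n))
  (Unique.cartesianProductWith⁺ (λ v a → a ∷ v) (Product.swap ∘ ∷-injective)
    (allVecs-unique l n) (Unique.allFin⁺ l))

module _ {l} (o : Fin l → Fin l → Bool) (α : Fin l) where

  σ-≤-of-injection : ∀ {r r′} (f : ∀ pos → InSigma o α r pos → Vec (Fin l) l) →
    (∀ pos (s : InSigma o α r pos) → InSigma o α r′ (f pos s)) →
    (∀ {pos pos′} (s : InSigma o α r pos) (s′ : InSigma o α r pos′) →
      f pos s ≡ f pos′ s′ → pos ≡ pos′) →
    σ o α r ≤ σ o α r′
  σ-≤-of-injection {r} {r′} =
    length-filter-≤-of-injection (InSigma? o α r) (InSigma? o α r′) (allVecs-unique l l) ∈-allVecs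

  σ≡0 : ∀ {r} → (∀ pos → ¬ InSigma o α r pos) → σ o α r ≡ 0
  σ≡0 {r} none = cong length (filter-none (InSigma? o α r) (All.universal none (allVecs l l)))

countAbove-moveUp : ∀ {n} α (pos pos′ : Vec (Fin (suc n)) (suc n)) →
  IsLinearOrder pos → IsLinearOrder pos′ →
  toℕ (lookup pos′ α) ≡ suc (toℕ (lookup pos α)) → countAbove pos α ≡ suc (countAbove pos′ α)
countAbove-moveUp {n} α pos pos′ linear linear′ step = +-cancelʳ-≡ (toℕ (lookup pos α)) _ _ (begin
  countAbove pos α + toℕ (lookup pos α)        ≡⟨ countAbove+position≡n pos α linear ⟩
  n                                            ≡⟨ countAbove+position≡n pos′ α linear′ ⟨
  countAbove pos′ α + toℕ (lookup pos′ α)      ≡⟨ cong (countAbove pos′ α +_) step ⟩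
  countAbove pos′ α + suc (toℕ (lookup pos α)) ≡⟨ +-suc _ _ ⟩
  suc (countAbove pos′ α) + toℕ (lookup pos α) ∎)
  where open ≡-Reasoning

IsLinearOrder-swapAdjacent : ∀ {n} (i : Fin n) (pos : Vec (Fin (suc n)) (suc n)) →
  IsLinearOrder pos → IsLinearOrder (Vec.map (swapAdjacent i) pos)
IsLinearOrder-swapAdjacent i pos linear a b e =
  linear a b (swapAdjacent-injective i (trans (sym (lookup-map a _ pos)) (trans e (lookup-map b _ pos))))

Compatible-swapAdjacent : ∀ {n} {o : Fin (suc n) → Fin (suc n) → Bool} (i : Fin n) pos →
  Compatible o pos →
  (∀ a b → lookup pos a ≡ inject₁ i → lookup pos b ≡ suc i → ¬ a ⟪ o ⟫ b) →
  Compatible o (Vec.map (swapAdjacent i) pos)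
Compatible-swapAdjacent i pos compatible no-edge a b a<b =
  subst₂ Fin._<_ (sym (lookup-map a _ pos)) (sym (lookup-map b _ pos))
    (swapAdjacent-< i (compatible a b a<b) (λ (a-at , b-at) → no-edge a b a-at b-at a<b))

swapAdjacent-map-cancel : ∀ {n m} {i j : Fin n} {u v : Vec (Fin (suc n)) m} → i ≡ j →
  Vec.map (swapAdjacent i) u ≡ Vec.map (swapAdjacent j) v → u ≡ v
swapAdjacent-map-cancel {i = i} refl = Vec-map-injective (swapAdjacent-injective i)

module _ {n} (o : Fin (suc n) → Fin (suc n) → Bool) (α : Fin (suc n)) where

  InSigma⇒r+position≡n : ∀ {r} pos → InSigma o α r pos → r + toℕ (lookup pos α) ≡ n
  InSigma⇒r+position≡n pos (linear , _ , refl) = countAbove+position≡n pos α linear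

  InSigma-suc⇒position≡inject₁ : ∀ {r} pos → InSigma o α (suc r) pos →
    ∃ λ i → lookup pos α ≡ inject₁ i
  InSigma-suc⇒position≡inject₁ pos s = lower₁ (lookup pos α) n≢p , sym (inject₁-lower₁ _ n≢p)
    where
    n≢p : n ≢ toℕ (lookup pos α)
    n≢p n≡p = m≢1+n+m _ (trans (sym n≡p) (sym (InSigma⇒r+position≡n pos s)))

  InSigma-<⇒position≡suc : ∀ {r} → r < n → ∀ pos → InSigma o α r pos →
    ∃ λ i → lookup pos α ≡ suc i
  InSigma-<⇒position≡suc {r} r<n pos s with lookup pos α | InSigma⇒r+position≡n pos s
  ... | zero  | r+0≡n = ⊥-elim (<-irrefl (trans (sym (+-identityʳ r)) r+0≡n) r<n)
  ... | suc i | _     = i , refl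

  sink⇒σ[1+r]≤σ[r] : (∀ β → ¬ α ⟪ o ⟫ β) → ∀ r → σ o α (suc r) ≤ σ o α r
  sink⇒σ[1+r]≤σ[r] sink r = σ-≤-of-injection o α raise raise-InSigma raise-injective
    where
    slot : ∀ pos → InSigma o α (suc r) pos → Fin n
    slot pos s = proj₁ (InSigma-suc⇒position≡inject₁ pos s)

    raise : ∀ pos → InSigma o α (suc r) pos → Vec (Fin (suc n)) (suc n)
    raise pos s = Vec.map (swapAdjacent (slot pos s)) pos

    raise-position : ∀ pos (s : InSigma o α (suc r) pos) → lookup (raise pos s) α ≡ suc (slot pos s)
    raise-position pos s = trans (lookup-map α _ pos)
      (trans (cong (swapAdjacent _) (proj₂ (InSigma-suc⇒position≡inject₁ pos s))) (swapAdjacent-inject₁ _))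

    raise-InSigma : ∀ pos (s : InSigma o α (suc r) pos) → InSigma o α r (raise pos s)
    raise-InSigma pos s@(linear , compatible , count) =
      linear′ , Compatible-swapAdjacent i pos compatible no-edge ,
      suc-injective (trans (sym (countAbove-moveUp α pos (raise pos s) linear linear′ step)) count)
      where
      i = slot pos s
      α-at-i = proj₂ (InSigma-suc⇒position≡inject₁ pos s)
      linear′ = IsLinearOrder-swapAdjacent i pos linear
      no-edge : ∀ a b → lookup pos a ≡ inject₁ i → lookup pos b ≡ suc i → ¬ a ⟪ o ⟫ b
      no-edge a b a-at _ with refl ← linear a α (trans a-at (sym α-at-i)) = sink b
      step : toℕ (lookup (raise pos s) α) ≡ suc (toℕ (lookup pos α))
      step = trans (cong toℕ (raise-position pos s))
        (cong suc (sym (trans (cong toℕ α-at-i) (toℕ-inject₁ i))))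

    raise-injective : ∀ {pos pos′} (s : InSigma o α (suc r) pos) (s′ : InSigma o α (suc r) pos′) →
      raise pos s ≡ raise pos′ s′ → pos ≡ pos′
    raise-injective {pos} {pos′} s s′ e = swapAdjacent-map-cancel (Finₚ.suc-injective
      (trans (sym (raise-position pos s)) (trans (cong (λ v → lookup v α) e) (raise-position pos′ s′)))) e

  source⇒σ[r]≤σ[1+r] : (∀ β → ¬ β ⟪ o ⟫ α) → ∀ {r} → r < n → σ o α r ≤ σ o α (suc r)
  source⇒σ[r]≤σ[1+r] source {r} r<n = σ-≤-of-injection o α lower lower-InSigma lower-injective
    where
    slot : ∀ pos → InSigma o α r pos → Fin n
    slot pos s = proj₁ (InSigma-<⇒position≡suc r<n pos s)

    lower : ∀ pos → InSigma o α r pos → Vec (Fin (suc n)) (suc n)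
    lower pos s = Vec.map (swapAdjacent (slot pos s)) pos

    lower-position : ∀ pos (s : InSigma o α r pos) → lookup (lower pos s) α ≡ inject₁ (slot pos s)
    lower-position pos s = trans (lookup-map α _ pos)
      (trans (cong (swapAdjacent _) (proj₂ (InSigma-<⇒position≡suc r<n pos s))) (swapAdjacent-suc _))

    lower-InSigma : ∀ pos (s : InSigma o α r pos) → InSigma o α (suc r) (lower pos s)
    lower-InSigma pos s@(linear , compatible , count) =
      linear′ , Compatible-swapAdjacent i pos compatible no-edge ,
      trans (countAbove-moveUp α (lower pos s) pos linear′ linear step) (cong suc count)
      where
      i = slot pos s
      α-at-suc-i = proj₂ (InSigma-<⇒position≡suc r<n pos s)
      linear′ = IsLinearOrder-swapAdjacent i pos linear
      no-edge : ∀ a b → lookup pos a ≡ inject₁ i → lookup pos b ≡ suc i → ¬ a ⟪ o ⟫ b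
      no-edge a b _ b-at with refl ← linear b α (trans b-at (sym α-at-suc-i)) = source a
      step : toℕ (lookup pos α) ≡ suc (toℕ (lookup (lower pos s) α))
      step = trans (cong toℕ α-at-suc-i)
        (cong suc (sym (trans (cong toℕ (lower-position pos s)) (toℕ-inject₁ i))))

    lower-injective : ∀ {pos pos′} (s : InSigma o α r pos) (s′ : InSigma o α r pos′) →
      lower pos s ≡ lower pos′ s′ → pos ≡ pos′
    lower-injective {pos} {pos′} s s′ e = swapAdjacent-map-cancel (Finₚ.inject₁-injective
      (trans (sym (lower-position pos s)) (trans (cong (λ v → lookup v α) e) (lower-position pos′ s′)))) e

  predecessor⇒σ[n]≡0 : ∀ {β} → β ⟪ o ⟫ α → σ o α n ≡ 0
  predecessor⇒σ[n]≡0 {β} β<α = σ≡0 o α impossible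
    where
    impossible : ∀ pos → ¬ InSigma o α n pos
    impossible pos s@(_ , compatible , _) =
      n≮0 (subst (toℕ (lookup pos β) <_) α-at-bottom (compatible β α β<α))
      where
      α-at-bottom : toℕ (lookup pos α) ≡ 0
      α-at-bottom = +-cancelˡ-≡ n _ 0 (trans (InSigma⇒r+position≡n pos s) (sym (+-identityʳ n)))

  successor⇒σ[0]≡0 : ∀ {β} → α ⟪ o ⟫ β → σ o α 0 ≡ 0
  successor⇒σ[0]≡0 {β} α<β = σ≡0 o α impossible
    where
    impossible : ∀ pos → ¬ InSigma o α 0 pos
    impossible pos s@(_ , compatible , _) =
      <-irrefl refl (<-≤-trans
        (subst (_< toℕ (lookup pos β)) (InSigma⇒r+position≡n pos s) (compatible α β α<β))
        (s≤s⁻¹ (toℕ<n (lookup pos β))))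

module _ {l} {Γ : Graph l} {o : Fin l → Fin l → Bool} (ao : IsAcyclicOrientation Γ o) where
  open IsAcyclicOrientation ao

  maximal⇒sink : ∀ {α} → IsMaximal Γ o α → ∀ β → ¬ α ⟪ o ⟫ β
  maximal⇒sink {α} maximal β α<β = notBoth α β α<β (maximal β (onlyEdges α β α<β))

  minimal⇒source : ∀ {α} → IsMinimal Γ o α → ∀ β → ¬ β ⟪ o ⟫ α
  minimal⇒source {α} minimal β β<α =
    notBoth β α β<α (minimal β (trans (Graph.sym Γ α β) (onlyEdges β α β<α)))

¬IsIsolated⇒neighbour : ∀ {l} (Γ : Graph l) α → ¬ IsIsolated Γ α → ∃ λ β → adj Γ α β ≡ true
¬IsIsolated⇒neighbour Γ α not-isolated with any? (λ β → adj Γ α β ≟ᵇ true)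
... | yes found = found
... | no none   = ⊥-elim (not-isolated (λ β → ¬-not (λ e → none (β , e))))

mainTheorem2 : (l : ℕ) (Γ : Graph l) (o : Fin l → Fin l → Bool)
    → IsAcyclicOrientation Γ o → (α : Fin l)
    → (IsMaximal Γ o α
        → (∀ r → suc r < l → σ o α (suc r) ≤ σ o α r)
          × (¬ IsIsolated Γ α → ∃ λ r → r < l × σ o α r ≡ 0))
      × (IsMinimal Γ o α
        → (∀ r → suc r < l → σ o α r ≤ σ o α (suc r))
          × (¬ IsIsolated Γ α → ∃ λ r → r < l × σ o α r ≡ 0))
mainTheorem2 (suc n) Γ o ao α =
    (λ maximal →
        (λ r _ → sink⇒σ[1+r]≤σ[r] o α (maximal⇒sink ao maximal) r)
      , λ not-isolated → let β , α~β = ¬IsIsolated⇒neighbour Γ α not-isolated in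
          n , ≤-refl , predecessor⇒σ[n]≡0 o α (maximal β α~β))
  , (λ minimal →
        (λ r 1+r<l → source⇒σ[r]≤σ[1+r] o α (minimal⇒source ao minimal) (s<s⁻¹ 1+r<l))
      , λ not-isolated → let β , α~β = ¬IsIsolated⇒neighbour Γ α not-isolated in
          0 , z<s , successor⇒σ[0]≡0 o α (minimal β α~β))
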